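{- Let $P$ be a list of permutations of $[0,1,\dots,n-1]$ and $\mathcal{F}$ a list of natural $nkm$-families (represented as $nkm$-lists). Then for every entry $F$ of $\mathcal{F}$ there is an entry $F'$ of $\mathrm{nef}(\mathcal{F},P)$ and a function $f$ injective on $\bigcup F$ with $\{f(A):A\in F\}=F'$.
   Context: A natural $nkm$-family: $m$ distinct $k$-element subsets of $\{0,\dots,n-1\}$, represented as an $nkm$-list (lexicographically sorted list without repetitions of length $m$ of sorted lists without repetitions of length $k$ with entries in $\{0,\dots,n-1\}$). $\mathrm{perm\_set}(A,p)=\mathrm{sort}(\mathrm{map}(\lambda x.\ p!x)\ A)$ with $p!x$ the $x$-th entry of $p$; $\mathrm{perm\_family}(F,p)=\mathrm{sort}(\mathrm{map}(\lambda A.\ \mathrm{perm\_set}(A,p))\ F)$. Define $\mathrm{nef}'([\,],P,\mathcal{F}_r)=\mathcal{F}_r$ and, for a list $F\#\mathcal{F}'$ with head $F$: $\mathrm{nef}'(F\#\mathcal{F}',P,\mathcal{F}_r)=\mathrm{nef}'(\mathrm{filter}(\lambda G.\ G\notin\mathcal{F}_F^P)(F\#\mathcal{F}'),P,F\#\mathcal{F}_r)$, where $\mathcal{F}_F^P=\mathrm{remdups}(\mathrm{map}(\lambda p.\ \mathrm{perm\_family}(F,p))\ P)$; and $\mathrm{nef}(\mathcal{F},P)=\mathrm{nef}'(\mathcal{F},P,[\,])$. -}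

module Defs where

open import Data.Nat using (ℕ; zero; suc; _<_; _≤ᵇ_; _<ᵇ_)
open import Data.Nat.Properties using (_≟_)
open import Data.Bool using (Bool; true; false; if_then_else_)
open import Data.List using (List; []; _∷_; map; length; filter; deduplicate; upTo)
open import Data.List.Properties using (≡-dec)
open import Data.List.Membership.Propositional using (_∈_)
open import Data.List.Relation.Unary.All using (All)
open import Data.List.Relation.Unary.Linked using (Linked)
open import Data.List.Relation.Binary.Permutation.Propositional using (_↭_)
open import Data.Product using (Σ; _×_; ∃; _,_)
open import Relation.Binary.PropositionalEquality using (_≡_)
open import Relation.Nullary using (¬_; Dec)
open import Relation.Nullary.Decidable using (¬?)
import Data.List.Membership.DecPropositional as DecMem

Set' : Set
Set' = List ℕ

Family : Set
Family = List (List ℕ)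

data _<ₗ_ : List ℕ → List ℕ → Set where
  []<∷  : ∀ {y ys} → [] <ₗ (y ∷ ys)
  head< : ∀ {x y xs ys} → x < y → (x ∷ xs) <ₗ (y ∷ ys)
  tail< : ∀ {x xs ys} → xs <ₗ ys → (x ∷ xs) <ₗ (x ∷ ys)

lexLeq : List ℕ → List ℕ → Bool
lexLeq [] _ = true
lexLeq (x ∷ xs) [] = false
lexLeq (x ∷ xs) (y ∷ ys) with x <ᵇ y | y <ᵇ x
... | true  | _     = true
... | false | true  = false
... | false | false = lexLeq xs ys

insertBy : {A : Set} → (A → A → Bool) → A → List A → List A
insertBy le x [] = x ∷ []
insertBy le x (y ∷ ys) = if le x y then x ∷ y ∷ ys else y ∷ insertBy le x ys

sortBy : {A : Set} → (A → A → Bool) → List A → List A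
sortBy le [] = []
sortBy le (x ∷ xs) = insertBy le x (sortBy le xs)

sortℕ : List ℕ → List ℕ
sortℕ = sortBy _≤ᵇ_

sortL : Family → Family
sortL = sortBy lexLeq

-- p ! x : the x-th entry of p (0 outside range; never used there under the hypotheses)
_!_ : List ℕ → ℕ → ℕ
[] ! _ = 0
(x ∷ xs) ! zero = x
(x ∷ xs) ! suc i = xs ! i

perm-set : List ℕ → List ℕ → List ℕ
perm-set A p = sortℕ (map (p !_) A)

perm-family : Family → List ℕ → Family
perm-family F p = sortL (map (λ A → perm-set A p) F)

_≟F_ : (F G : Family) → Dec (F ≡ G)
_≟F_ = ≡-dec (≡-dec _≟_)

open DecMem _≟F_ using () renaming (_∈?_ to _∈F?_)

orbit : Family → List (List ℕ) → List Family
orbit F P = deduplicate _≟F_ (map (perm-family F) P)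

-- nef' with fuel (fuel = length of the input list is always sufficient,
-- since each step strictly shortens the list being processed)
nef'-fuel : ℕ → List Family → List (List ℕ) → List Family → List Family
nef'-fuel zero _ P R = R
nef'-fuel (suc n) [] P R = R
nef'-fuel (suc n) (F ∷ 𝓕') P R =
  nef'-fuel n (filter (λ G → ¬? (G ∈F? orbit F P)) 𝓕') P (F ∷ R)

nef' : List Family → List (List ℕ) → List Family → List Family
nef' 𝓕 P R = nef'-fuel (length 𝓕) 𝓕 P R

nef : List Family → List (List ℕ) → List Family
nef 𝓕 P = nef' 𝓕 P []

IsNKSet : ℕ → ℕ → List ℕ → Set
IsNKSet n k A = Linked _<_ A × length A ≡ k × All (_< n) A

IsNKMList : ℕ → ℕ → ℕ → Family → Set
IsNKMList n k m F = Linked _<ₗ_ F × length F ≡ m × All (IsNKSet n k) F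

IsPermOf : ℕ → List ℕ → Set
IsPermOf n p = p ↭ upTo n

_∈⋃_ : ℕ → Family → Set
x ∈⋃ F = Σ (List ℕ) λ A → A ∈ F × x ∈ A

InjOn : (ℕ → ℕ) → Family → Set
InjOn f F = ∀ x y → x ∈⋃ F → y ∈⋃ F → f x ≡ f y → x ≡ y

_≈ₛ_ : List ℕ → List ℕ → Set
A ≈ₛ B = (∀ x → x ∈ A → x ∈ B) × (∀ x → x ∈ B → x ∈ A)

-- {f(A) : A ∈ F} = F'  (as sets of sets)
ImageFamilyEq : (ℕ → ℕ) → Family → Family → Set
ImageFamilyEq f F F' =
  (∀ A → A ∈ F → Σ (List ℕ) λ B → B ∈ F' × map f A ≈ₛ B) ×
  (∀ B → B ∈ F' → Σ (List ℕ) λ A → A ∈ F × map f A ≈ₛ B)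

module Submission where

-- Idea.  nef' walks through the list; when it keeps the head F it only
-- discards families lying in the orbit of F, i.e. families of the form
-- perm-family F p with p ∈ P.  Such a family is isomorphic to F: the
-- inverse permutation x ↦ idx x p is injective on its ground set and maps
-- each block perm-set A p back onto A.  Hence an induction over the run of
-- nef' (driven by its fuel) shows that every input family is isomorphic to
-- some family in the output, and the theorem is the case of empty
-- accumulator and fuel = length of the input.

open import Defs
open import Data.Nat using (ℕ; zero; suc; _<_; _≤_; _≤ᵇ_; s≤s)
open import Data.Nat.Properties using (_≟_; ≤-trans; ≤-refl)
open import Data.Bool using (Bool; true; false)
open import Data.List using (List; []; _∷_; map; length; filter)
open import Data.List.Properties using (length-filter; length-upTo; map-id)
open import Data.List.Membership.Propositional using (_∈_)
open import Data.List.Membership.Propositional.Properties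
  using (∈-map⁺; ∈-map⁻; ∈-filter⁺; ∈-deduplicate⁻)
open import Data.List.Relation.Unary.Any using (here; there)
open import Data.List.Relation.Unary.All as All using (All; []; _∷_)
open import Data.List.Relation.Unary.All.Properties using (filter⁺)
open import Data.List.Relation.Unary.AllPairs using (_∷_)
open import Data.List.Relation.Unary.Unique.Propositional using (Unique)
open import Data.List.Relation.Unary.Unique.Propositional.Properties using (upTo⁺)
open import Data.List.Relation.Binary.Permutation.Propositional using (↭⇒↭ₛ; ↭-sym)
open import Data.List.Relation.Binary.Permutation.Propositional.Properties using (↭-length)
import Data.List.Relation.Binary.Permutation.Setoid.Properties as PermSetoid
open import Data.Product using (Σ; _×_; ∃; _,_; proj₂)
open import Data.Sum using (_⊎_; inj₁; inj₂)
open import Data.Empty using (⊥-elim)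
open import Relation.Nullary using (yes; no)
open import Relation.Nullary.Decidable using (¬?)
open import Relation.Binary.PropositionalEquality
  using (_≡_; refl; sym; trans; cong; subst; setoid; module ≡-Reasoning)
import Data.List.Membership.DecPropositional as DecMem

open DecMem _≟F_ using () renaming (_∈?_ to _∈F?_)

module _ {A : Set} (le : A → A → Bool) where

  ∈-insertBy-new : ∀ a ys → a ∈ insertBy le a ys
  ∈-insertBy-new a [] = here refl
  ∈-insertBy-new a (y ∷ ys) with le a y
  ... | true  = here refl
  ... | false = there (∈-insertBy-new a ys)

  ∈-insertBy-old : ∀ {x} a ys → x ∈ ys → x ∈ insertBy le a ys
  ∈-insertBy-old a (y ∷ ys) x∈ with le a y
  ∈-insertBy-old a (y ∷ ys) x∈          | true  = there x∈
  ∈-insertBy-old a (y ∷ ys) (here x≡y)  | false = here x≡y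
  ∈-insertBy-old a (y ∷ ys) (there x∈)  | false = there (∈-insertBy-old a ys x∈)

  ∈-insertBy⁻ : ∀ {x} a ys → x ∈ insertBy le a ys → x ≡ a ⊎ x ∈ ys
  ∈-insertBy⁻ a [] (here x≡a) = inj₁ x≡a
  ∈-insertBy⁻ a (y ∷ ys) x∈ with le a y
  ∈-insertBy⁻ a (y ∷ ys) (here x≡a)  | true  = inj₁ x≡a
  ∈-insertBy⁻ a (y ∷ ys) (there x∈)  | true  = inj₂ x∈
  ∈-insertBy⁻ a (y ∷ ys) (here x≡y)  | false = inj₂ (here x≡y)
  ∈-insertBy⁻ a (y ∷ ys) (there x∈)  | false with ∈-insertBy⁻ a ys x∈
  ... | inj₁ x≡a = inj₁ x≡a
  ... | inj₂ x∈ys = inj₂ (there x∈ys)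

  ∈-sortBy⁺ : ∀ {x} xs → x ∈ xs → x ∈ sortBy le xs
  ∈-sortBy⁺ (y ∷ ys) (here refl) = ∈-insertBy-new y (sortBy le ys)
  ∈-sortBy⁺ (y ∷ ys) (there x∈)  = ∈-insertBy-old y (sortBy le ys) (∈-sortBy⁺ ys x∈)

  ∈-sortBy⁻ : ∀ {x} xs → x ∈ sortBy le xs → x ∈ xs
  ∈-sortBy⁻ (y ∷ ys) x∈ with ∈-insertBy⁻ y (sortBy le ys) x∈
  ... | inj₁ x≡y  = here x≡y
  ... | inj₂ x∈ys = there (∈-sortBy⁻ ys x∈ys)

idx : ℕ → List ℕ → ℕ
idx y [] = 0
idx y (z ∷ zs) with y ≟ z
... | yes _ = 0
... | no  _ = suc (idx y zs)

!-∈ : ∀ p {x} → x < length p → p ! x ∈ p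
!-∈ (z ∷ zs) {zero}  _       = here refl
!-∈ (z ∷ zs) {suc x} (s≤s l) = there (!-∈ zs l)

!-idx : ∀ {y} p → y ∈ p → p ! idx y p ≡ y
!-idx {y} (z ∷ zs) y∈ with y ≟ z
!-idx {y} (z ∷ zs) y∈          | yes y≡z = sym y≡z
!-idx {y} (z ∷ zs) (here y≡z)  | no  y≢z = ⊥-elim (y≢z y≡z)
!-idx {y} (z ∷ zs) (there y∈)  | no  _   = !-idx zs y∈

idx-! : ∀ p {x} → Unique p → x < length p → idx (p ! x) p ≡ x
idx-! (z ∷ zs) {zero} _ _ with z ≟ z
... | yes _   = refl
... | no  z≢z = ⊥-elim (z≢z refl)
idx-! (z ∷ zs) {suc x} (z∉zs ∷ u) (s≤s l) with zs ! x ≟ z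
... | yes e = ⊥-elim (All.lookup z∉zs (!-∈ zs l) (sym e))
... | no  _ = cong suc (idx-! zs u l)

_≅_ : Family → Family → Set
G ≅ F' = Σ (ℕ → ℕ) λ f → InjOn f G × ImageFamilyEq f G F'

≅-refl : ∀ F → F ≅ F
≅-refl F = (λ x → x) , (λ _ _ _ _ e → e) ,
  (λ A A∈ → A , A∈ , map-id-≈ₛ A) , (λ B B∈ → B , B∈ , map-id-≈ₛ B)
  where
  map-id-≈ₛ : ∀ A → map (λ x → x) A ≈ₛ A
  map-id-≈ₛ A rewrite map-id A = (λ _ x∈ → x∈) , (λ _ x∈ → x∈)

Bounded : ℕ → Family → Set
Bounded n F = All (All (_< n)) F

module InversePermutation {n : ℕ} (p : List ℕ) (p-perm : IsPermOf n p) where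

  length-p : length p ≡ n
  length-p = trans (↭-length p-perm) (length-upTo n)

  unique-p : Unique p
  unique-p = PermSetoid.Unique-resp-↭ (setoid ℕ) (↭⇒↭ₛ (↭-sym p-perm)) (upTo⁺ n)

  valid : ∀ {x} → x < n → x < length p
  valid = subst (_ <_) (sym length-p)

  p⁻¹ : ℕ → ℕ
  p⁻¹ y = idx y p

  p⁻¹-p : ∀ {x} → x < n → p⁻¹ (p ! x) ≡ x
  p⁻¹-p x<n = idx-! p unique-p (valid x<n)

  ∈-perm-set⁻ : ∀ {y} B → y ∈ perm-set B p → ∃ λ b → b ∈ B × y ≡ p ! b
  ∈-perm-set⁻ B y∈ = ∈-map⁻ (p !_) (∈-sortBy⁻ _≤ᵇ_ (map (p !_) B) y∈)

  p⁻¹-perm-set : ∀ B → All (_< n) B → map p⁻¹ (perm-set B p) ≈ₛ B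
  p⁻¹-perm-set B B<n = to , from
    where
    to : ∀ z → z ∈ map p⁻¹ (perm-set B p) → z ∈ B
    to z z∈ with ∈-map⁻ p⁻¹ z∈
    ... | y , y∈ , refl with ∈-perm-set⁻ B y∈
    ... | b , b∈ , refl = subst (_∈ B) (sym (p⁻¹-p (All.lookup B<n b∈))) b∈
    from : ∀ b → b ∈ B → b ∈ map p⁻¹ (perm-set B p)
    from b b∈ = subst (_∈ map p⁻¹ (perm-set B p)) (p⁻¹-p (All.lookup B<n b∈))
      (∈-map⁺ p⁻¹ (∈-sortBy⁺ _≤ᵇ_ (map (p !_) B) (∈-map⁺ (p !_) b∈)))

  perm-family-≅ : ∀ F → Bounded n F → perm-family F p ≅ F
  perm-family-≅ F F<n = p⁻¹ , injective , forward , backward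
    where
    G = perm-family F p

    ∈-G⁻ : ∀ {A} → A ∈ G → ∃ λ B → B ∈ F × A ≡ perm-set B p
    ∈-G⁻ A∈ = ∈-map⁻ (λ B → perm-set B p) (∈-sortBy⁻ lexLeq _ A∈)

    ground-∈-p : ∀ x → x ∈⋃ G → x ∈ p
    ground-∈-p x (A , A∈ , x∈A) with ∈-G⁻ A∈
    ... | B , B∈ , refl with ∈-perm-set⁻ B x∈A
    ... | b , b∈ , refl = !-∈ p (valid (All.lookup (All.lookup F<n B∈) b∈))

    injective : InjOn p⁻¹ G
    injective x y x∈ y∈ e = begin
      x            ≡⟨ sym (!-idx p (ground-∈-p x x∈)) ⟩
      p ! p⁻¹ x    ≡⟨ cong (p !_) e ⟩
      p ! p⁻¹ y    ≡⟨ !-idx p (ground-∈-p y y∈) ⟩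
      y            ∎
      where open ≡-Reasoning

    forward : ∀ A → A ∈ G → Σ (List ℕ) λ B → B ∈ F × map p⁻¹ A ≈ₛ B
    forward A A∈ with ∈-G⁻ A∈
    ... | B , B∈ , refl = B , B∈ , p⁻¹-perm-set B (All.lookup F<n B∈)

    backward : ∀ B → B ∈ F → Σ (List ℕ) λ A → A ∈ G × map p⁻¹ A ≈ₛ B
    backward B B∈ = perm-set B p ,
      ∈-sortBy⁺ lexLeq _ (∈-map⁺ (λ B → perm-set B p) B∈) ,
      p⁻¹-perm-set B (All.lookup F<n B∈)

orbit-≅ : ∀ {n G} F P → All (IsPermOf n) P → Bounded n F → G ∈ orbit F P → G ≅ F
orbit-≅ F P P-perm F<n G∈ with ∈-map⁻ (perm-family F) (∈-deduplicate⁻ _≟F_ _ G∈)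
... | p , p∈ , refl = InversePermutation.perm-family-≅ p (All.lookup P-perm p∈) F F<n

survivors : Family → List (List ℕ) → List Family → List Family
survivors F P = filter (λ G → ¬? (G ∈F? orbit F P))

nef'-retains : ∀ fuel L P R {F} → F ∈ R → F ∈ nef'-fuel fuel L P R
nef'-retains zero       L       P R F∈ = F∈
nef'-retains (suc fuel) []      P R F∈ = F∈
nef'-retains (suc fuel) (F ∷ L) P R F∈ =
  nef'-retains fuel (survivors F P L) P (F ∷ R) (there F∈)

-- With enough fuel, every processed family is isomorphic to an output one:
-- the head is kept, discarded families are isomorphic to the head, and the
-- remaining ones are handled by the recursive call.
nef'-covers : ∀ {n} P → All (IsPermOf n) P → ∀ fuel L R →
  length L ≤ fuel → All (Bounded n) L →
  ∀ {G} → G ∈ L → Σ Family λ F' → F' ∈ nef'-fuel fuel L P R × G ≅ F'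
nef'-covers P P-perm (suc fuel) (F ∷ L) R (s≤s len≤) (F<n ∷ L<n) {G} G∈ = cover G∈
  where
  output = nef'-fuel fuel (survivors F P L) P (F ∷ R)

  F-kept : F ∈ output
  F-kept = nef'-retains fuel _ P (F ∷ R) (here refl)

  cover : G ∈ F ∷ L → Σ Family λ F' → F' ∈ output × G ≅ F'
  cover (here refl) = F , F-kept , ≅-refl F
  cover (there G∈L) with G ∈F? orbit F P
  ... | yes G∈orbit = F , F-kept , orbit-≅ F P P-perm F<n G∈orbit
  ... | no  G∉orbit = nef'-covers P P-perm fuel (survivors F P L) (F ∷ R)
          (≤-trans (length-filter _ L) len≤) (filter⁺ _ L<n)
          (∈-filter⁺ _ G∈L G∉orbit)

lemma6 : (n k m : ℕ) (P : List (List ℕ)) (𝓕 : List Family) →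
    All (IsPermOf n) P →
    All (IsNKMList n k m) 𝓕 →
    ∀ F → F ∈ 𝓕 →
    Σ Family λ F' → F' ∈ nef 𝓕 P ×
      Σ (ℕ → ℕ) λ f → InjOn f F × ImageFamilyEq f F F'
lemma6 n k m P 𝓕 P-perm 𝓕-nkm F F∈ =
  nef'-covers P P-perm (length 𝓕) 𝓕 [] ≤-refl 𝓕-bounded F∈
  where
  𝓕-bounded : All (Bounded n) 𝓕
  𝓕-bounded = All.map (λ nkm → All.map (λ nk → proj₂ (proj₂ nk)) (proj₂ (proj₂ nkm))) 𝓕-nkm
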